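{- Let $\lambda=(n_1,\dots,n_r)$ be an attainable partition of a positive integer $n$. Then for every $k$ with $1<k\leq r$ we have $n_k\leq \dfrac{n}{k(k-1)}$.
   Context: A partition of a positive integer $n$ is a tuple $\lambda=(n_1,n_2,\dots,n_r)$ of positive integers with $n_1\geq n_2\geq\dots\geq n_r$ and $n_1+\dots+n_r=n$. The cyclicity index of $\lambda$ is $c(\lambda)=\sum_{i=1}^r(3-2i)n_i$, and $\lambda$ is attainable if $c(\lambda)\geq 0$. -}

module Defs where
open import Data.Nat using (ℕ; zero; suc; _≥_; _<_)
open import Data.Integer as ℤ using (ℤ; +_)
open import Data.List using (List; [] ; _∷_; length)
open import Data.Nat.ListAction using (sum)
open import Data.List.Relation.Unary.All using (All)
open import Data.List.Relation.Unary.Linked using (Linked)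
open import Data.Product using (_×_)
open import Relation.Binary.PropositionalEquality using (_≡_)

IsPartition : ℕ → List ℕ → Set
IsPartition n λs = All (λ m → 0 < m) λs × Linked _≥_ λs × sum λs ≡ n

cycAux : ℕ → List ℕ → ℤ
cycAux i [] = + 0
cycAux i (m ∷ ms) = (+ 3 ℤ.- (+ 2) ℤ.* (+ i)) ℤ.* (+ m) ℤ.+ cycAux (suc i) ms

cyclicity : List ℕ → ℤ
cyclicity λs = cycAux 1 λs

Attainable : List ℕ → Set
Attainable λs = + 0 ℤ.≤ cyclicity λs

-- Writing c(λ) = n − Σᵢ 2(i−1)nᵢ, attainability says Σᵢ 2(i−1)nᵢ ≤ n. Since the
-- parts decrease, the first k terms of that sum are at least
-- (Σ_{i<k} 2i)·n_k = k(k−1)·n_k.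
module Submission where

open import Defs
open import Data.Nat using (ℕ; suc; _*_; _≤_; _<_; _+_; _≥_)
open import Data.Nat.Properties
  using (≤-trans; ≤-reflexive; m≤m+n; +-mono-≤; *-monoʳ-≤)
open import Data.Nat.ListAction using (sum)
import Data.Nat.Tactic.RingSolver as ℕ-Ring
open import Data.Integer as ℤ using (ℤ; +_)
import Data.Integer.Properties as ℤ
import Data.Integer.Tactic.RingSolver as ℤ-Ring
open import Data.List using (List; []; _∷_; length; lookup)
open import Data.List.Membership.Propositional.Properties using (∈-lookup)
import Data.List.Relation.Unary.All as All
import Data.List.Relation.Unary.AllPairs as AllPairs
open import Data.List.Relation.Unary.Linked as Linked using (Linked)
open import Data.List.Relation.Unary.Linked.Properties using (Linked⇒AllPairs)
open import Data.Fin using (Fin; toℕ; zero; suc)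
open import Data.Product using (_,_)
open import Function using (flip)
open import Relation.Binary.PropositionalEquality

-- cycDefect j (m₀, m₁, …) = Σₜ 2(j+t)·mₜ, so cycDefect 0 λ = n − c(λ).
cycDefect : ℕ → List ℕ → ℕ
cycDefect j [] = 0
cycDefect j (m ∷ ms) = 2 * j * m + cycDefect (suc j) ms

cycAux+cycDefect≡sum : ∀ j ms → cycAux (suc j) ms ℤ.+ + cycDefect j ms ≡ + sum ms
cycAux+cycDefect≡sum j [] = refl
cycAux+cycDefect≡sum j (m ∷ ms) = begin
  cycAux (suc j) (m ∷ ms) ℤ.+ + (2 * j * m + d)
    ≡⟨ cong (ℤ._+_ (cycAux (suc j) (m ∷ ms))) +-2jm+d ⟩
  ((+ 3 ℤ.- + 2 ℤ.* (+ 1 ℤ.+ + j)) ℤ.* + m ℤ.+ c) ℤ.+ (+ 2 ℤ.* + j ℤ.* + m ℤ.+ + d)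
    ≡⟨ coefficients-cancel (+ j) (+ m) c (+ d) ⟩
  + m ℤ.+ (c ℤ.+ + d)
    ≡⟨ cong (ℤ._+_ (+ m)) (cycAux+cycDefect≡sum (suc j) ms) ⟩
  + m ℤ.+ + sum ms
    ≡⟨ ℤ.pos-+ m (sum ms) ⟨
  + sum (m ∷ ms) ∎
  where
  open ≡-Reasoning
  c = cycAux (suc (suc j)) ms
  d = cycDefect (suc j) ms

  +-2jm+d : + (2 * j * m + d) ≡ + 2 ℤ.* + j ℤ.* + m ℤ.+ + d
  +-2jm+d = begin
    + (2 * j * m + d)          ≡⟨ ℤ.pos-+ (2 * j * m) d ⟩
    + (2 * j * m) ℤ.+ + d      ≡⟨ cong (ℤ._+ + d) (ℤ.pos-* (2 * j) m) ⟩
    + (2 * j) ℤ.* + m ℤ.+ + d  ≡⟨ cong (λ t → t ℤ.* + m ℤ.+ + d) (ℤ.pos-* 2 j) ⟩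
    + 2 ℤ.* + j ℤ.* + m ℤ.+ + d ∎

  coefficients-cancel : ∀ (j m c d : ℤ) →
    ((+ 3 ℤ.- + 2 ℤ.* (+ 1 ℤ.+ j)) ℤ.* m ℤ.+ c) ℤ.+ (+ 2 ℤ.* j ℤ.* m ℤ.+ d) ≡ m ℤ.+ (c ℤ.+ d)
  coefficients-cancel = ℤ-Ring.solve-∀

attainable⇒cycDefect≤sum : ∀ λs → Attainable λs → cycDefect 0 λs ≤ sum λs
attainable⇒cycDefect≤sum λs att = ℤ.drop‿+≤+ (subst (+ cycDefect 0 λs ℤ.≤_)
  (cycAux+cycDefect≡sum 0 λs) (ℤ.+-monoˡ-≤ (+ cycDefect 0 λs) att))

lookup≤head : ∀ {m ms} → Linked _≥_ (m ∷ ms) → (i : Fin (length ms)) → lookup ms i ≤ m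
lookup≤head l i = All.lookup (AllPairs.head (Linked⇒AllPairs (flip ≤-trans) l)) (∈-lookup i)

-- The first i+1 weights 2(j+t) sum to (i+1)(2j+i), and each part among them is ≥ mᵢ.
cycDefect-lookup : ∀ j ms → Linked _≥_ ms → (i : Fin (length ms)) →
                   suc (toℕ i) * (2 * j + toℕ i) * lookup ms i ≤ cycDefect j ms
cycDefect-lookup j (m ∷ ms) l zero =
  ≤-trans (≤-reflexive (first-weight j m)) (m≤m+n (2 * j * m) (cycDefect (suc j) ms))
  where
  first-weight : ∀ j m → 1 * (2 * j + 0) * m ≡ 2 * j * m
  first-weight = ℕ-Ring.solve-∀
cycDefect-lookup j (m ∷ ms) l (suc i) =
  ≤-trans (≤-reflexive (split-weights j (toℕ i) (lookup ms i)))
    (+-mono-≤ (*-monoʳ-≤ (2 * j) (lookup≤head l i))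
              (cycDefect-lookup (suc j) ms (Linked.tail l) i))
  where
  split-weights : ∀ j i x →
    suc (suc i) * (2 * j + suc i) * x ≡ 2 * j * x + suc i * (2 * suc j + i) * x
  split-weights = ℕ-Ring.solve-∀

lemma4p1 : (n : ℕ) → 0 < n → (λs : List ℕ) → IsPartition n λs → Attainable λs →
           (i : Fin (length λs)) → 1 < suc (toℕ i) →
           suc (toℕ i) * toℕ i * lookup λs i ≤ n
lemma4p1 n _ λs (_ , decreasing , refl) att i _ =
  ≤-trans (cycDefect-lookup 0 λs decreasing i) (attainable⇒cycDefect≤sum λs att)
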